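{- Let $k$ be a positive integer with $$k\equiv 10131316054712759135960334995313053617046 \pmod{20263657997642451746458664712008831939580}.$$ Then the equation $\frac{n}{2^{n}}=\sum_{i=1}^{k}\frac{a_{i}}{2^{a_{i}}}$ has at least five solutions $(n,a_1,\ldots,a_k)$ in positive integers with $a_1<a_2<\cdots<a_k$.
   Context: For fixed $k$, a solution is a tuple of positive integers $n$ and $a_1<\cdots<a_k$ satisfying the equation; the number of such solutions is denoted $N(k)$, and the claim is $N(k)\geq 5$. -}

module Defs where

open import Data.Nat using (ℕ; zero; suc; _^_; _<_; _≤_)
open import Data.Nat.Properties using (m^n≢0)
open import Data.Integer using (+_)
open import Data.Rational using (ℚ; _/_; _+_; 0ℚ)
open import Data.Fin using (Fin)
import Data.Fin as Fin
open import Data.Vec using (Vec; lookup; foldr)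
open import Data.Product using (_×_)
open import Relation.Binary.PropositionalEquality using (_≡_)

term : ℕ → ℚ
term m = _/_ (+ m) (2 ^ m) {{m^n≢0 2 m}}

sumTerms : ∀ {k} → Vec ℕ k → ℚ
sumTerms = foldr _ (λ x acc → term x + acc) 0ℚ

IsSolution : (k : ℕ) → ℕ → Vec ℕ k → Set
IsSolution k n a =
  (1 ≤ n) ×
  ((i : Fin k) → 1 ≤ lookup a i) ×
  ((i j : Fin k) → i Fin.< j → lookup a i < lookup a j) ×
  (term n ≡ sumTerms a)

{-# OPTIONS --safe #-}
-- Write k = j + 2. For a gap u ≥ 1 take n = m and a = (m+1, …, m+j, m+j+u, m+j+u+1).
-- Since Σ_{i ≥ s} i/2^i = (2s+2)/2^s, the consecutive block telescopes, and over the
-- common denominator 2^(m+j+u+1) the equation becomes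
--   (m+j+u+1)(2^(u+1) − 3) = 2^(j+u+2) + 2(u−1)2^u − 2,
-- which has a solution m ≥ 1 as soon as 2^(u+1) − 3 divides the right-hand side (j is huge).
-- For u ∈ {1, 4, 11, 24, 101} the order of 2 modulo 2^(u+1) − 3 divides the period
-- 20263657997642451746458664712008831939580, so the divisibility depends only on the residue
-- of j, where it is checked by fast modular exponentiation. Different gaps give different
-- solutions.
module Submission where

open import Data.Fin using (Fin)
open import Data.Integer as ℤ using (+_)
open import Data.Integer.Properties using (pos-*; pos-+)
open import Data.Nat
  using (ℕ; zero; suc; pred; _+_; _*_; _^_; _∸_; _%_; _/_; _≤_; _<_; z≤n; s≤s; NonZero; >-nonZero)
open import Data.Nat.Binary as ℕᵇ using (ℕᵇ; 2[1+_]; 1+[2_])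
open import Data.Nat.Binary.Properties using (toℕ-fromℕ)
open import Data.Nat.Divisibility using (_∣_; divides)
open import Data.Nat.DivMod using (%-distribˡ-*; %-distribˡ-+; m%n%n≡m%n; m≡m%n+[m/n]*n)
open import Data.Nat.Properties
  using (_≟_; ≤ᵇ⇒≤; suc-injective; +-suc; +-assoc; +-comm; +-identityʳ; *-comm; *-identityʳ; *-suc;
         +-cancelˡ-≡; +-cancelʳ-≡; +-cancelʳ-≤; *-cancelʳ-≤; ^-distribˡ-+-*; ^-*-assoc; *-distribʳ-∸;
         [m+n]∸[m+o]≡n∸o; m∸n+n≡m; m∸n≤m; m<n⇒0<n∸m; m^n≢0; m*n≢0; m^n>0;
         ≤-refl; ≤-trans; ≤-reflexive; <⇒≤; <-trans; <-≤-trans; n<1+n; n≤1+n; m≤m+n;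
         +-mono-≤; +-monoʳ-≤; *-mono-≤; *-monoʳ-≤; ∸-monoˡ-≤; module ≤-Reasoning)
open import Data.Nat.Tactic.RingSolver using (solve-∀)
open import Data.Product using (Σ; _×_; _,_; proj₁; proj₂)
open import Data.Rational as ℚ using (toℚᵘ; fromℚᵘ)
open import Data.Rational.Properties using (toℚᵘ-homo-+; toℚᵘ-fromℚᵘ; toℚᵘ-injective)
open import Data.Rational.Unnormalised as ℚᵘ using (ℚᵘ; _≃_; *≡*; 0ℚᵘ) renaming (_+_ to _⊕_)
open import Data.Rational.Unnormalised.Properties
  using (≃-refl; ≃-sym; ≃-trans; ≃-reflexive; /-cong; module ≃-Reasoning)
  renaming (+-cong to ⊕-cong; +-congˡ to ⊕-congˡ; +-congʳ to ⊕-congʳ; +-assoc to ⊕-assoc;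
            +-comm to ⊕-comm; +-identityʳ to ⊕-identityʳ; +-cancelʳ to ⊕-cancelʳ)
open import Data.Unit using (tt)
open import Data.Vec using (Vec; []; _∷_; last; lookup)
open import Data.Vec.Relation.Unary.All using (All; []; _∷_)
import Data.Vec.Relation.Unary.All.Properties as All
open import Data.Vec.Relation.Unary.AllPairs using (allPairs?)
open import Data.Vec.Relation.Unary.Linked using (Linked; [-]; _∷_)
open import Data.Vec.Relation.Unary.Linked.Properties using (Linked⇒All; lookup⁺)
open import Data.Vec.Relation.Unary.Unique.Propositional using (Unique)
open import Data.Vec.Relation.Unary.Unique.Propositional.Properties using (lookup-injective)
open import Function.Definitions using (Injective)
open import Relation.Binary.PropositionalEquality
  using (_≡_; refl; sym; trans; cong; cong₂; subst; module ≡-Reasoning)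
open import Relation.Nullary.Decidable using (toWitness; ¬?)

open import Defs

infix 7 _/ᵘ_

_/ᵘ_ : ℕ → (d : ℕ) → .{{NonZero d}} → ℚᵘ
a /ᵘ d = + a ℚᵘ./ d

/ᵘ-≃ : ∀ a b c d .{{_ : NonZero b}} .{{_ : NonZero d}} → a * d ≡ c * b → a /ᵘ b ≃ c /ᵘ d
/ᵘ-≃ a (suc b) c (suc d) eq = *≡* (trans (sym (pos-* a (suc d))) (trans (cong +_ eq) (pos-* c (suc b))))

/ᵘ-+ : ∀ a b c d .{{_ : NonZero b}} .{{_ : NonZero d}} →
       a /ᵘ b ⊕ c /ᵘ d ≃ _/ᵘ_ (a * d + c * b) (b * d) {{m*n≢0 b d}}
/ᵘ-+ a (suc b) c (suc d) = ≃-reflexive (/-cong numerator refl)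
  where
  numerator : + a ℤ.* + suc d ℤ.+ + c ℤ.* + suc b ≡ + (a * suc d + c * suc b)
  numerator = trans (cong₂ ℤ._+_ (sym (pos-* a (suc d))) (sym (pos-* c (suc b))))
                    (sym (pos-+ (a * suc d) (c * suc b)))

/ᵘ-+-/ᵘ : ∀ a c d .{{_ : NonZero d}} → a /ᵘ d ⊕ c /ᵘ d ≃ (a + c) /ᵘ d
/ᵘ-+-/ᵘ a c d = ≃-trans (/ᵘ-+ a d c d) (/ᵘ-≃ _ _ _ _ {{m*n≢0 d d}} (common a c d))
  where
  common : ∀ a c d → (a * d + c * d) * d ≡ (a + c) * (d * d)
  common = solve-∀

dyadic : ℕ → ℕ → ℚᵘ
dyadic p e = _/ᵘ_ p (2 ^ e) {{m^n≢0 2 e}}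

dyadic-rescale : ∀ p q e f → 2 ^ e * q ≡ 2 ^ f → dyadic p e ≃ dyadic (p * q) f
dyadic-rescale p q e f eq =
  /ᵘ-≃ p (2 ^ e) (p * q) (2 ^ f) {{m^n≢0 2 e}} {{m^n≢0 2 f}}
    (trans (cong (p *_) (sym eq)) (regroup p (2 ^ e) q))
  where
  regroup : ∀ p E q → p * (E * q) ≡ p * q * E
  regroup = solve-∀

dyadic-+ : ∀ p q e → dyadic p e ⊕ dyadic q e ≃ dyadic (p + q) e
dyadic-+ p q e = /ᵘ-+-/ᵘ p q (2 ^ e) {{m^n≢0 2 e}}

sumᵘ : ∀ {n} → Vec ℕ n → ℚᵘ
sumᵘ []      = 0ℚᵘ
sumᵘ (a ∷ v) = dyadic a a ⊕ sumᵘ v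

toℚᵘ-term : ∀ m → toℚᵘ (term m) ≃ dyadic m m
toℚᵘ-term m =
  subst (λ q → toℚᵘ q ≃ dyadic m m) (fromℚᵘ-/ m (2 ^ m) {{m^n≢0 2 m}}) (toℚᵘ-fromℚᵘ (dyadic m m))
  where
  fromℚᵘ-/ : ∀ a d .{{_ : NonZero d}} → fromℚᵘ (a /ᵘ d) ≡ + a ℚ./ d
  fromℚᵘ-/ a (suc d) = refl

toℚᵘ-sumTerms : ∀ {n} (v : Vec ℕ n) → toℚᵘ (sumTerms v) ≃ sumᵘ v
toℚᵘ-sumTerms []      = ≃-refl
toℚᵘ-sumTerms (a ∷ v) =
  ≃-trans (toℚᵘ-homo-+ (term a) (sumTerms v)) (⊕-cong (toℚᵘ-term a) (toℚᵘ-sumTerms v))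

term-≡-sumTerms : ∀ m {n} (v : Vec ℕ n) → dyadic m m ≃ sumᵘ v → term m ≡ sumTerms v
term-≡-sumTerms m v eq = toℚᵘ-injective (≃-trans (toℚᵘ-term m) (≃-trans eq (≃-sym (toℚᵘ-sumTerms v))))

-- Σ_{i ≥ s} i / 2^i
tailSum : ℕ → ℚᵘ
tailSum s = dyadic (2 * s + 2) s

tailSum-step : ∀ s → dyadic s s ⊕ tailSum (suc s) ≃ tailSum s
tailSum-step s = begin
  dyadic s s ⊕ tailSum (suc s)                ≈⟨ ⊕-congˡ (tailSum (suc s)) (dyadic-rescale s 2 s (suc s) (*-comm (2 ^ s) 2)) ⟩
  dyadic (s * 2) (suc s) ⊕ tailSum (suc s)    ≈⟨ dyadic-+ (s * 2) (2 * suc s + 2) (suc s) ⟩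
  dyadic (s * 2 + (2 * suc s + 2)) (suc s)    ≡⟨ cong (λ p → dyadic p (suc s)) (numerators s) ⟩
  dyadic ((2 * s + 2) * 2) (suc s)            ≈⟨ dyadic-rescale (2 * s + 2) 2 s (suc s) (*-comm (2 ^ s) 2) ⟨
  tailSum s                                   ∎
  where
  open ≃-Reasoning
  numerators : ∀ s → s * 2 + (2 * suc s + 2) ≡ (2 * s + 2) * 2
  numerators = solve-∀

consecutiveThen : ℕ → (j : ℕ) → ℕ → ℕ → Vec ℕ (suc (suc j))
consecutiveThen s zero    x y = x ∷ y ∷ []
consecutiveThen s (suc j) x y = s ∷ consecutiveThen (suc s) j x y

sumᵘ-consecutiveThen : ∀ s j x y →
  sumᵘ (consecutiveThen s j x y) ⊕ tailSum (j + s) ≃ (tailSum s ⊕ dyadic x x) ⊕ dyadic y y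
sumᵘ-consecutiveThen s zero x y = begin
  (dyadic x x ⊕ (dyadic y y ⊕ 0ℚᵘ)) ⊕ tailSum s  ≈⟨ ⊕-congˡ (tailSum s) (⊕-congʳ (dyadic x x) (⊕-identityʳ (dyadic y y))) ⟩
  (dyadic x x ⊕ dyadic y y) ⊕ tailSum s          ≈⟨ ⊕-comm (dyadic x x ⊕ dyadic y y) (tailSum s) ⟩
  tailSum s ⊕ (dyadic x x ⊕ dyadic y y)          ≈⟨ ⊕-assoc (tailSum s) (dyadic x x) (dyadic y y) ⟨
  (tailSum s ⊕ dyadic x x) ⊕ dyadic y y          ∎
  where open ≃-Reasoning
sumᵘ-consecutiveThen s (suc j) x y =
  subst (λ t → (dyadic s s ⊕ rest) ⊕ tailSum t ≃ (tailSum s ⊕ X) ⊕ Y) (+-suc j s) (begin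
  (dyadic s s ⊕ rest) ⊕ tailSum (j + suc s)           ≈⟨ ⊕-assoc (dyadic s s) rest (tailSum (j + suc s)) ⟩
  dyadic s s ⊕ (rest ⊕ tailSum (j + suc s))           ≈⟨ ⊕-congʳ (dyadic s s) (sumᵘ-consecutiveThen (suc s) j x y) ⟩
  dyadic s s ⊕ ((tailSum (suc s) ⊕ X) ⊕ Y)            ≈⟨ ⊕-assoc (dyadic s s) (tailSum (suc s) ⊕ X) Y ⟨
  (dyadic s s ⊕ (tailSum (suc s) ⊕ X)) ⊕ Y            ≈⟨ ⊕-congˡ Y (⊕-assoc (dyadic s s) (tailSum (suc s)) X) ⟨
  ((dyadic s s ⊕ tailSum (suc s)) ⊕ X) ⊕ Y            ≈⟨ ⊕-congˡ Y (⊕-congˡ X (tailSum-step s)) ⟩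
  (tailSum s ⊕ X) ⊕ Y                                 ∎)
  where
  open ≃-Reasoning
  rest : ℚᵘ
  rest = sumᵘ (consecutiveThen (suc s) j x y)
  X : ℚᵘ
  X = dyadic x x
  Y : ℚᵘ
  Y = dyadic y y

closing-numerators : ∀ m j w P A X → X + 3 ≡ 2 * A →
  suc (m + j + suc w) * X + 2 ≡ P * (4 * A) + 2 * w * A →
  m * (P * (2 * A)) + (2 * (j + suc m) + 2) * A
    ≡ ((2 * suc m + 2) * (P * A) + (m + j + suc w) * 2) + suc (m + j + suc w)
closing-numerators m j w P A X X+3≡2A quotient = +-cancelʳ-≡ K _ _ (begin
  m * (P * (2 * A)) + (2 * (j + suc m) + 2) * A + K  ≡⟨ collect m j w P A ⟩
  (2 * suc m + 2) * (P * A) + y * (2 * A)           ≡⟨ cong (λ t → (2 * suc m + 2) * (P * A) + y * t) (sym X+3≡2A) ⟩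
  (2 * suc m + 2) * (P * A) + y * (X + 3)           ≡⟨ expand m j w P A X ⟩
  rhs + (y * X + 2)                                 ≡⟨ cong (λ t → rhs + t) quotient ⟩
  rhs + K                                           ∎)
  where
  open ≡-Reasoning
  y : ℕ
  y = suc (m + j + suc w)
  K : ℕ
  K = P * (4 * A) + 2 * w * A
  rhs : ℕ
  rhs = ((2 * suc m + 2) * (P * A) + (m + j + suc w) * 2) + y
  collect : ∀ m j w P A → m * (P * (2 * A)) + (2 * (j + suc m) + 2) * A + (P * (4 * A) + 2 * w * A)
                          ≡ (2 * suc m + 2) * (P * A) + suc (m + j + suc w) * (2 * A)
  collect = solve-∀
  expand : ∀ m j w P A X → (2 * suc m + 2) * (P * A) + suc (m + j + suc w) * (X + 3)
                           ≡ ((2 * suc m + 2) * (P * A) + (m + j + suc w) * 2) + suc (m + j + suc w)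
                             + (suc (m + j + suc w) * X + 2)
  expand = solve-∀

closing-identity : ∀ m j w X → X + 3 ≡ 2 * 2 ^ suc w →
  suc (m + j + suc w) * X + 2 ≡ 2 ^ j * (4 * 2 ^ suc w) + 2 * w * 2 ^ suc w →
  let x = m + j + suc w in
  dyadic m m ⊕ tailSum (j + suc m) ≃ (tailSum (suc m) ⊕ dyadic x x) ⊕ dyadic (suc x) (suc x)
closing-identity m j w X X+3≡2A quotient = begin
  dyadic m m ⊕ tailSum (j + suc m)
    ≈⟨ ⊕-cong (dyadic-rescale m (P * (2 * A)) m y (via (shift₁ a P A)))
              (dyadic-rescale (2 * (j + suc m) + 2) A (j + suc m) y
                 (trans (cong (_* A) (^-distribˡ-+-* 2 j (suc m))) (via (shift₂ a P A)))) ⟩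
  dyadic (m * (P * (2 * A))) y ⊕ dyadic ((2 * (j + suc m) + 2) * A) y
    ≈⟨ dyadic-+ (m * (P * (2 * A))) ((2 * (j + suc m) + 2) * A) y ⟩
  dyadic (m * (P * (2 * A)) + (2 * (j + suc m) + 2) * A) y
    ≡⟨ cong (λ p → dyadic p y) (closing-numerators m j w P A X X+3≡2A quotient) ⟩
  dyadic (((2 * suc m + 2) * (P * A) + x * 2) + y) y
    ≈⟨ dyadic-+ ((2 * suc m + 2) * (P * A) + x * 2) y y ⟨
  dyadic ((2 * suc m + 2) * (P * A) + x * 2) y ⊕ dyadic y y
    ≈⟨ ⊕-congˡ (dyadic y y) (dyadic-+ ((2 * suc m + 2) * (P * A)) (x * 2) y) ⟨
  (dyadic ((2 * suc m + 2) * (P * A)) y ⊕ dyadic (x * 2) y) ⊕ dyadic y y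
    ≈⟨ ⊕-congˡ (dyadic y y) (⊕-cong (dyadic-rescale (2 * suc m + 2) (P * A) (suc m) y (via (shift₃ a P A)))
                                    (dyadic-rescale x 2 x y (*-comm (2 ^ x) 2))) ⟨
  (tailSum (suc m) ⊕ dyadic x x) ⊕ dyadic y y
    ∎
  where
  open ≃-Reasoning
  x : ℕ
  x = m + j + suc w
  y : ℕ
  y = suc x
  a : ℕ
  a = 2 ^ m
  P : ℕ
  P = 2 ^ j
  A : ℕ
  A = 2 ^ suc w
  2^x≡aPA : 2 ^ x ≡ a * P * A
  2^x≡aPA = trans (^-distribˡ-+-* 2 (m + j) (suc w)) (cong (_* A) (^-distribˡ-+-* 2 m j))
  via : ∀ {n} → n ≡ 2 * (a * P * A) → n ≡ 2 ^ y
  via eq = trans eq (cong (2 *_) (sym 2^x≡aPA))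
  shift₁ : ∀ a P A → a * (P * (2 * A)) ≡ 2 * (a * P * A)
  shift₁ = solve-∀
  shift₂ : ∀ a P A → P * (2 * a) * A ≡ 2 * (a * P * A)
  shift₂ = solve-∀
  shift₃ : ∀ a P A → 2 * a * (P * A) ≡ 2 * (a * P * A)
  shift₃ = solve-∀

consecutiveThen-linked : ∀ {lo} s j x y → lo < s → j + s ≤ x → x < y →
  Linked _<_ (lo ∷ consecutiveThen s j x y)
consecutiveThen-linked s zero    x y lo<s s≤x x<y = <-≤-trans lo<s s≤x ∷ x<y ∷ [-]
consecutiveThen-linked s (suc j) x y lo<s 1+j+s≤x x<y =
  lo<s ∷ consecutiveThen-linked (suc s) j x y (n<1+n s) (subst (_≤ x) (sym (+-suc j s)) 1+j+s≤x) x<y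

last-consecutiveThen : ∀ s j x y → last (consecutiveThen s j x y) ≡ y
last-consecutiveThen s zero    x y = refl
last-consecutiveThen s (suc j) x y = last-consecutiveThen (suc s) j x y

isSolution : ∀ {k} n (a : Vec ℕ k) → 1 ≤ n → Linked _<_ (0 ∷ a) → term n ≡ sumTerms a → IsSolution k n a
isSolution n []      1≤n _              eq = 1≤n , (λ ()) , (λ ()) , eq
isSolution n (a ∷ v) 1≤n (0<a ∷ linked) eq =
  1≤n , All.lookup⁺ (Linked⇒All <-trans 0<a linked) , (λ _ _ → lookup⁺ <-trans linked) , eq

*-%-cong : ∀ {a a′ b b′} d .{{_ : NonZero d}} →
  a % d ≡ a′ % d → b % d ≡ b′ % d → a * b % d ≡ a′ * b′ % d
*-%-cong {a} {a′} {b} {b′} d eqa eqb =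
  trans (%-distribˡ-* a b d) (trans (cong₂ (λ s t → s * t % d) eqa eqb) (sym (%-distribˡ-* a′ b′ d)))

*-%-congʳ : ∀ a {b b′} d .{{_ : NonZero d}} → b % d ≡ b′ % d → a * b % d ≡ a * b′ % d
*-%-congʳ a d = *-%-cong {a} {a} d refl

+-%-congˡ : ∀ {a a′} c d .{{_ : NonZero d}} → a % d ≡ a′ % d → (a + c) % d ≡ (a′ + c) % d
+-%-congˡ {a} {a′} c d eq =
  trans (%-distribˡ-+ a c d) (trans (cong (λ s → (s + c % d) % d) eq) (sym (%-distribˡ-+ a′ c d)))

^-%-one : ∀ a q d .{{_ : NonZero d}} → a % d ≡ 1 % d → a ^ q % d ≡ 1 % d
^-%-one a zero    d _  = refl
^-%-one a (suc q) d eq = *-%-cong d eq (^-%-one a q d eq)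

^-%-periodic : ∀ b r q L d .{{_ : NonZero d}} → b ^ L % d ≡ 1 % d → b ^ (r + q * L) % d ≡ b ^ r % d
^-%-periodic b r q L d period = begin
  b ^ (r + q * L) % d         ≡⟨ cong (_% d) (^-distribˡ-+-* b r (q * L)) ⟩
  b ^ r * b ^ (q * L) % d     ≡⟨ cong (λ e → b ^ r * b ^ e % d) (*-comm q L) ⟩
  b ^ r * b ^ (L * q) % d     ≡⟨ cong (λ t → b ^ r * t % d) (^-*-assoc b L q) ⟨
  b ^ r * (b ^ L) ^ q % d     ≡⟨ *-%-congʳ (b ^ r) d (^-%-one (b ^ L) q d period) ⟩
  b ^ r * 1 % d               ≡⟨ cong (_% d) (*-identityʳ (b ^ r)) ⟩
  b ^ r % d                   ∎
  where open ≡-Reasoning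

%≡%⇒∣∸ : ∀ m n d .{{_ : NonZero d}} → m % d ≡ n % d → d ∣ m ∸ n
%≡%⇒∣∸ m n d eq = divides (m / d ∸ n / d) (begin
  m ∸ n                                      ≡⟨ cong₂ _∸_ (m≡m%n+[m/n]*n m d) (m≡m%n+[m/n]*n n d) ⟩
  (m % d + m / d * d) ∸ (n % d + n / d * d)  ≡⟨ cong (λ r → (r + m / d * d) ∸ (n % d + n / d * d)) eq ⟩
  (n % d + m / d * d) ∸ (n % d + n / d * d)  ≡⟨ [m+n]∸[m+o]≡n∸o (n % d) (m / d * d) (n / d * d) ⟩
  m / d * d ∸ n / d * d                      ≡⟨ *-distribʳ-∸ d (m / d) (n / d) ⟨
  (m / d ∸ n / d) * d                        ∎)
  where open ≡-Reasoning

-- Matching forces the argument before it is duplicated; otherwise evaluating pow2Modᵇ takes exponential time.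
square : ℕ → ℕ
square zero        = zero
square n@(suc _)   = n * n

square-≡ : ∀ n → square n ≡ n * n
square-≡ zero    = refl
square-≡ (suc n) = refl

^-double : ∀ b n → b ^ (2 * n) ≡ b ^ n * b ^ n
^-double b n = trans (cong (λ e → b ^ (n + e)) (+-identityʳ n)) (^-distribˡ-+-* b n n)

pow2Modᵇ : ∀ d .{{_ : NonZero d}} → ℕᵇ → ℕ
pow2Modᵇ d ℕᵇ.zero   = 1 % d
pow2Modᵇ d 2[1+ b ]  = square (2 * pow2Modᵇ d b) % d
pow2Modᵇ d 1+[2 b ]  = 2 * square (pow2Modᵇ d b) % d

pow2Modᵇ-correct : ∀ d .{{_ : NonZero d}} b → pow2Modᵇ d b ≡ 2 ^ ℕᵇ.toℕ b % d
pow2Modᵇ-correct d ℕᵇ.zero   = refl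
pow2Modᵇ-correct d 2[1+ b ]  = begin
  square (2 * r) % d                 ≡⟨ cong (_% d) (square-≡ (2 * r)) ⟩
  2 * r * (2 * r) % d                ≡⟨ *-%-cong d 2r≡ 2r≡ ⟩
  2 * 2 ^ t * (2 * 2 ^ t) % d        ≡⟨ cong (_% d) (^-double 2 (suc t)) ⟨
  2 ^ (2 * suc t) % d                ∎
  where
  open ≡-Reasoning
  r : ℕ
  r = pow2Modᵇ d b
  t : ℕ
  t = ℕᵇ.toℕ b
  2r≡ : 2 * r % d ≡ 2 * 2 ^ t % d
  2r≡ = *-%-congʳ 2 d (trans (cong (_% d) (pow2Modᵇ-correct d b)) (m%n%n≡m%n (2 ^ t) d))
pow2Modᵇ-correct d 1+[2 b ]  = begin
  2 * square r % d                   ≡⟨ cong (λ s → 2 * s % d) (square-≡ r) ⟩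
  2 * (r * r) % d                    ≡⟨ *-%-congʳ 2 d (*-%-cong d r≡ r≡) ⟩
  2 * (2 ^ t * 2 ^ t) % d            ≡⟨ cong (λ s → 2 * s % d) (^-double 2 t) ⟨
  2 * 2 ^ (2 * t) % d                ∎
  where
  open ≡-Reasoning
  r : ℕ
  r = pow2Modᵇ d b
  t : ℕ
  t = ℕᵇ.toℕ b
  r≡ : r % d ≡ 2 ^ t % d
  r≡ = trans (cong (_% d) (pow2Modᵇ-correct d b)) (m%n%n≡m%n (2 ^ t) d)

pow2Modᵇ-fromℕ : ∀ d .{{_ : NonZero d}} n → pow2Modᵇ d (ℕᵇ.fromℕ n) ≡ 2 ^ n % d
pow2Modᵇ-fromℕ d n = trans (pow2Modᵇ-correct d (ℕᵇ.fromℕ n)) (cong (λ e → 2 ^ e % d) (toℕ-fromℕ n))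

modulus : ℕ → ℕ
modulus u = 2 * 2 ^ u ∸ 3

4≤2*2^[1+n] : ∀ n → 4 ≤ 2 * 2 ^ suc n
4≤2*2^[1+n] n = *-monoʳ-≤ 2 (*-monoʳ-≤ 2 (m^n>0 2 n))

modulus-+3 : ∀ w → modulus (suc w) + 3 ≡ 2 * 2 ^ suc w
modulus-+3 w = m∸n+n≡m (≤-trans (n≤1+n 3) (4≤2*2^[1+n] w))

modulus-positive : ∀ w → 1 ≤ modulus (suc w)
modulus-positive w = ∸-monoˡ-≤ 3 (4≤2*2^[1+n] w)

2*n≤2^n : ∀ n → 2 * n ≤ 2 ^ n
2*n≤2^n zero          = z≤n
2*n≤2^n (suc zero)    = ≤-refl
2*n≤2^n (suc (suc n)) = begin
  2 * suc (suc n)          ≡⟨ *-suc 2 (suc n) ⟩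
  2 + 2 * suc n            ≤⟨ +-mono-≤ (≤-trans (*-monoʳ-≤ 2 (s≤s z≤n)) (2*n≤2^n (suc n))) (2*n≤2^n (suc n)) ⟩
  2 ^ suc n + 2 ^ suc n    ≡⟨ cong (λ t → 2 ^ suc n + t) (sym (+-identityʳ (2 ^ suc n))) ⟩
  2 * 2 ^ suc n            ∎
  where open ≤-Reasoning

GapSolution : ℕ → ℕ → Set
GapSolution j u = Σ (ℕ × Vec ℕ (suc (suc j))) λ s →
  IsSolution (suc (suc j)) (proj₁ s) (proj₂ s) × last (proj₂ s) ≡ suc (proj₁ s + j + u)

gap-determined : ∀ {j u u′} (s : GapSolution j u) (s′ : GapSolution j u′) →
  proj₁ s ≡ proj₁ s′ → u ≡ u′
gap-determined {j} ((n , a) , _ , last≡) (_ , _ , last≡′) refl =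
  +-cancelˡ-≡ (n + j) _ _ (suc-injective (trans (sym last≡) last≡′))

-- m is determined by (m + j + u + 1) · modulus u + 2 ≡ target u j.
target : ℕ → ℕ → ℕ
target u j = 2 ^ j * (4 * 2 ^ u) + 2 * pred u * 2 ^ u

2≤target : ∀ u j → 2 ≤ target u j
2≤target u j = ≤-trans (*-mono-≤ (m^n>0 2 j) (≤-trans (s≤s (s≤s z≤n)) (*-monoʳ-≤ 4 (m^n>0 2 u))))
                       (m≤m+n (2 ^ j * (4 * 2 ^ u)) (2 * pred u * 2 ^ u))

target-lower-bound : ∀ u j → 2 + u ≤ j → (2 + j + u) * modulus u + 2 ≤ target u j
target-lower-bound u j 2+u≤j = begin
  (2 + j + u) * modulus u + 2          ≤⟨ +-mono-≤ (*-mono-≤ 2+j+u≤2^j (m∸n≤m (2 * A) 3)) 2≤2^j*2A ⟩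
  2 ^ j * (2 * A) + 2 ^ j * (2 * A)    ≡⟨ double (2 ^ j) A ⟩
  2 ^ j * (4 * A)                      ≤⟨ m≤m+n (2 ^ j * (4 * A)) (2 * pred u * A) ⟩
  target u j                           ∎
  where
  open ≤-Reasoning
  A : ℕ
  A = 2 ^ u
  2+j+u≤2^j : 2 + j + u ≤ 2 ^ j
  2+j+u≤2^j = begin
    2 + j + u        ≡⟨ cong suc (+-suc j u) ⟨
    suc (j + suc u)  ≡⟨ +-suc j (suc u) ⟨
    j + (2 + u)  ≤⟨ +-monoʳ-≤ j 2+u≤j ⟩
    j + j        ≡⟨ cong (λ t → j + t) (+-identityʳ j) ⟨
    2 * j        ≤⟨ 2*n≤2^n j ⟩
    2 ^ j        ∎
  2≤2^j*2A : 2 ≤ 2 ^ j * (2 * A)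
  2≤2^j*2A = *-mono-≤ (m^n>0 2 j) (*-monoʳ-≤ 2 (m^n>0 2 u))
  double : ∀ P A → P * (2 * A) + P * (2 * A) ≡ P * (4 * A)
  double = solve-∀

target-divisible : ∀ u L r q .{{_ : NonZero (modulus u)}} →
  pow2Modᵇ (modulus u) (ℕᵇ.fromℕ L) ≡ 1 % modulus u →
  (pow2Modᵇ (modulus u) (ℕᵇ.fromℕ r) * (4 * 2 ^ u) + 2 * pred u * 2 ^ u) % modulus u ≡ 2 % modulus u →
  modulus u ∣ target u (r + q * L) ∸ 2
target-divisible u L r q period-check residue-check = %≡%⇒∣∸ (target u (r + q * L)) 2 X (begin
  target u (r + q * L) % X     ≡⟨ +-%-congˡ (2 * pred u * 2 ^ u) X (*-%-cong X 2^[r+qL]≡p refl) ⟩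
  (p * (4 * 2 ^ u) + 2 * pred u * 2 ^ u) % X   ≡⟨ residue-check ⟩
  2 % X                        ∎)
  where
  open ≡-Reasoning
  X : ℕ
  X = modulus u
  p : ℕ
  p = pow2Modᵇ X (ℕᵇ.fromℕ r)
  2^[r+qL]≡p : 2 ^ (r + q * L) % X ≡ p % X
  2^[r+qL]≡p = trans (^-%-periodic 2 r q L X (trans (sym (pow2Modᵇ-fromℕ X L)) period-check))
                     (sym (trans (cong (_% X) (pow2Modᵇ-fromℕ X r)) (m%n%n≡m%n (2 ^ r) X)))

solution-with-gap : ∀ u j → 1 ≤ u → 2 + u ≤ j → modulus u ∣ target u j ∸ 2 → GapSolution j u
solution-with-gap (suc w) j _ 2+u≤j (divides M target∸2≡MX) =
  (m , a) , isSolution m a (m<n⇒0<n∸m c<M) linked (term-≡-sumTerms m a (≃-sym sum≃))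
          , last-consecutiveThen (suc m) j x (suc x)
  where
  u : ℕ
  u = suc w
  X : ℕ
  X = modulus u
  c : ℕ
  c = suc (j + u)
  MX+2≡target : M * X + 2 ≡ target u j
  MX+2≡target = trans (cong (_+ 2) (sym target∸2≡MX)) (m∸n+n≡m (2≤target u j))
  c<M : c < M
  c<M = *-cancelʳ-≤ (suc c) M X {{>-nonZero (modulus-positive w)}}
          (+-cancelʳ-≤ 2 _ _ (≤-trans (target-lower-bound u j 2+u≤j) (≤-reflexive (sym MX+2≡target))))
  m : ℕ
  m = M ∸ c
  x : ℕ
  x = m + j + u
  1+x≡M : suc x ≡ M
  1+x≡M = trans (cong suc (+-assoc m j u)) (trans (sym (+-suc m (j + u))) (m∸n+n≡m (<⇒≤ c<M)))
  a : Vec ℕ (suc (suc j))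
  a = consecutiveThen (suc m) j x (suc x)
  linked : Linked _<_ (0 ∷ a)
  linked = consecutiveThen-linked (suc m) j x (suc x) (s≤s z≤n) j+1+m≤x (n<1+n x)
    where
    j+1+m≤x : j + suc m ≤ x
    j+1+m≤x = begin
      j + suc m          ≡⟨ +-suc j m ⟩
      suc (j + m)        ≡⟨ cong suc (+-comm j m) ⟩
      suc (m + j)        ≤⟨ s≤s (m≤m+n (m + j) w) ⟩
      suc (m + j + w)    ≡⟨ +-suc (m + j) w ⟨
      x                  ∎
      where open ≤-Reasoning
  sum≃ : sumᵘ a ≃ dyadic m m
  sum≃ = ⊕-cancelʳ (≃-trans (sumᵘ-consecutiveThen (suc m) j x (suc x))
           (≃-sym (closing-identity m j w X (modulus-+3 w) (trans (cong (λ t → t * X + 2) 1+x≡M) MX+2≡target))))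

period : ℕ
period = 20263657997642451746458664712008831939580

-- j = k − 2 lies in this residue class modulo period.
residue : ℕ
residue = 10131316054712759135960334995313053617044

-- j stays a variable, constrained by an equation: were a term residue + q * period ever
-- normalised, Agda's arithmetic would unfold the literal residue into successors.
certified-solution : ∀ j q → j ≡ residue + q * period →
  ∀ u .{{_ : NonZero (modulus u)}} → 1 ≤ u → 2 + u ≤ residue →
  pow2Modᵇ (modulus u) (ℕᵇ.fromℕ period) ≡ 1 % modulus u →
  (pow2Modᵇ (modulus u) (ℕᵇ.fromℕ residue) * (4 * 2 ^ u) + 2 * pred u * 2 ^ u) % modulus u ≡ 2 % modulus u →
  GapSolution j u
certified-solution j q j≡ u positive small period-check residue-check =
  solution-with-gap u j positive (subst (2 + u ≤_) (sym j≡) (≤-trans small (m≤m+n residue (q * period))))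
    (subst (λ t → modulus u ∣ target u t ∸ 2) (sym j≡)
      (target-divisible u period residue q period-check residue-check))

gaps : Vec ℕ 5
gaps = 1 ∷ 4 ∷ 11 ∷ 24 ∷ 101 ∷ []

gaps-unique : Unique gaps
gaps-unique = toWitness {a? = allPairs? (λ m n → ¬? (m ≟ n)) gaps} tt

solutions : ∀ j q → j ≡ residue + q * period → All (GapSolution j) gaps
solutions j q j≡ =
  certified-solution j q j≡ 1   (s≤s z≤n) (≤ᵇ⇒≤ _ _ tt) refl refl ∷
  certified-solution j q j≡ 4   (s≤s z≤n) (≤ᵇ⇒≤ _ _ tt) refl refl ∷
  certified-solution j q j≡ 11  (s≤s z≤n) (≤ᵇ⇒≤ _ _ tt) refl refl ∷
  certified-solution j q j≡ 24  (s≤s z≤n) (≤ᵇ⇒≤ _ _ tt) refl refl ∷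
  certified-solution j q j≡ 101 (s≤s z≤n) (≤ᵇ⇒≤ _ _ tt) refl refl ∷ []

FiveSolutions : ℕ → Set
FiveSolutions k = Σ (Fin 5 → ℕ × Vec ℕ k) λ sol →
  Injective _≡_ _≡_ sol × ((i : Fin 5) → IsSolution k (proj₁ (sol i)) (proj₂ (sol i)))

five-solutions : ∀ j q → j ≡ residue + q * period → FiveSolutions (suc (suc j))
five-solutions j q j≡ = (λ i → proj₁ (solution i)) , injective , λ i → proj₁ (proj₂ (solution i))
  where
  solution : ∀ i → GapSolution j (lookup gaps i)
  solution = All.lookup⁺ (solutions j q j≡)
  injective : Injective _≡_ _≡_ (λ i → proj₁ (solution i))
  injective {i} {i′} eq = lookup-injective gaps-unique i i′ (gap-determined (solution i) (solution i′) eq)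

%-elim : ∀ (P : ℕ → Set) k L r .{{_ : NonZero L}} → k % L ≡ suc (suc r) →
  (∀ j → j ≡ r + k / L * L → P (suc (suc j))) → P k
%-elim P k L r k%L≡ f = subst P (sym k≡) (f (r + k / L * L) refl)
  where
  k≡ : k ≡ suc (suc (r + k / L * L))
  k≡ = trans (m≡m%n+[m/n]*n k L) (cong (_+ k / L * L) k%L≡)

proposition3p1 : (k : ℕ) → 1 ≤ k
    → k % 20263657997642451746458664712008831939580 ≡ 10131316054712759135960334995313053617046
    → Σ (Fin 5 → ℕ × Vec ℕ k) λ sol →
        Injective _≡_ _≡_ sol × ((i : Fin 5) → IsSolution k (proj₁ (sol i)) (proj₂ (sol i)))
proposition3p1 k _ k%period≡ = %-elim FiveSolutions k period residue k%period≡ (λ j → five-solutions j (k / period))
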